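{- For every integer $n\ge 3$, $R_c(C_n)=\overline{R}((C_n,\lhd_{mon});2)$.
   Context: $C_n$ is the cycle on $n$ vertices. For a finite set $P$ of points in the plane in general position (no three collinear), the complete geometric graph $K_P$ has vertex set $P$ and all straight-line segments between pairs of points of $P$ as edges; it is convex if $P$ is in convex position. The convex geometric Ramsey number $R_c(G)$ is the smallest $N$ such that every convex complete geometric graph $K_P$ with $|P|=N$ whose edges are colored with two colors contains a monochromatic copy of $G$ whose edges are pairwise non-crossing. An ordered graph is a graph with a total ordering of its vertices; copies must preserve orderings. The monotone cycle $(C_n,\lhd_{mon})$ has vertices $v_1\lhd_{mon}\cdots\lhd_{mon}v_n$ and edges $\{v_i,v_{i+1}\}$ ($1\le i<n$) and $\{v_1,v_n\}$. $\overline{R}(\mathcal{G};2)$ is the smallest $N$ such that every 2-coloring of the edges of the complete graph on $N$ totally ordered vertices contains a monochromatic ordered copy of $\mathcal{G}$. -}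

module Defs where

open import Data.Nat using (ℕ; zero; suc; _≤_; _<_; _⊓_; _⊔_)
open import Data.Nat.DivMod using (_mod_)
open import Data.Fin using (Fin; toℕ)
open import Data.Bool using (Bool)
open import Data.Product using (_×_; Σ; ∃)
open import Data.Sum using (_⊎_)
open import Relation.Nullary using (¬_)
open import Relation.Binary.PropositionalEquality using (_≡_)
open import Function.Definitions using (Injective)

next : ∀ {n} → Fin n → Fin n
next {suc m} i = suc (toℕ i) mod (suc m)

-- a 2-colouring of the edges of the complete graph on vertex set Fin N
-- (only its values on pairs i ≠ j matter; symmetry is required separately)
Coloring : ℕ → Set
Coloring N = Fin N → Fin N → Bool

Symmetric : ∀ {N} → Coloring N → Set
Symmetric {N} c = ∀ (i j : Fin N) → c i j ≡ c j i

StrictlyInside : ∀ {N} → Fin N → Fin N → Fin N → Set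
StrictlyInside a b x = (toℕ a ⊓ toℕ b) < toℕ x × toℕ x < (toℕ a ⊔ toℕ b)

StrictlyOutside : ∀ {N} → Fin N → Fin N → Fin N → Set
StrictlyOutside a b x = toℕ x < (toℕ a ⊓ toℕ b) ⊎ (toℕ a ⊔ toℕ b) < toℕ x

-- Convex complete geometric graph on N points: the points are labelled
-- 0,…,N-1 in their cyclic order along the convex hull.  Two segments
-- {a,b} and {c,d} cross iff their endpoints are four distinct points that
-- interleave in this cyclic order.
Cross : ∀ {N} → Fin N → Fin N → Fin N → Fin N → Set
Cross a b c d = (StrictlyInside a b c × StrictlyOutside a b d)
              ⊎ (StrictlyInside a b d × StrictlyOutside a b c)

NonCrossingMonoCycle : ∀ {N} (n : ℕ) → Coloring N → Set
NonCrossingMonoCycle {N} n c =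
  Σ Bool λ col → Σ (Fin n → Fin N) λ f →
    Injective _≡_ _≡_ f
    × (∀ i → c (f i) (f (next i)) ≡ col)
    × (∀ i j → ¬ Cross (f i) (f (next i)) (f j) (f (next j)))

-- a monochromatic ordered copy of the monotone cycle (C_n, ◁_mon):
-- strictly increasing f with edges {f i, f (i+1)} and {f 0, f (n-1)}
MonotoneMonoCycle : ∀ {N} (n : ℕ) → Coloring N → Set
MonotoneMonoCycle {N} n c =
  Σ Bool λ col → Σ (Fin n → Fin N) λ f →
    (∀ i j → toℕ i < toℕ j → toℕ (f i) < toℕ (f j))
    × (∀ i → c (f i) (f (next i)) ≡ col)

ConvexRamseyProp : ℕ → ℕ → Set
ConvexRamseyProp n N = ∀ (c : Coloring N) → Symmetric c → NonCrossingMonoCycle n c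

OrderedRamseyProp : ℕ → ℕ → Set
OrderedRamseyProp n N = ∀ (c : Coloring N) → Symmetric c → MonotoneMonoCycle n c

IsLeast : (ℕ → Set) → ℕ → Set
IsLeast P R = P R × (∀ M → P M → R ≤ M)

IsConvexRamseyNumber : ℕ → ℕ → Set
IsConvexRamseyNumber n = IsLeast (ConvexRamseyProp n)

IsOrderedRamseyNumber : ℕ → ℕ → Set
IsOrderedRamseyNumber n = IsLeast (OrderedRamseyProp n)

{-# OPTIONS --safe #-}
-- An increasing cycle drawn on points in convex position is the boundary of their convex hull, so it
-- does not cross itself.  Conversely, in a non-crossing copy of C_n no edge has one vertex strictly
-- inside it and another strictly outside: the rest of the cycle is a path between them avoiding the
-- edge's endpoints, and wherever it changes sides it crosses the edge.  Start the cycle at its least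
-- label, reflecting it if necessary so that the second vertex is smaller than the last.  The first
-- vertex then lies outside every edge not incident to it and the last vertex outside the first edge,
-- so no vertex lies strictly between two consecutive vertices of the path from first to last; such a
-- path is increasing, which makes this rotation of the cycle a monotone copy with the same edges.
-- Hence both Ramsey properties hold for exactly the same N, and so do their least witnesses.
module Submission where

open import Defs
open import Data.Bool using (Bool)
open import Data.Empty using (⊥-elim)
open import Data.Fin using (Fin; toℕ; opposite)
open import Data.Fin.Properties
  using (toℕ-injective; toℕ<n; toℕ≤pred[n]; toℕ-fromℕ<; opposite-prop; opposite-involutive)
open import Data.List using (allFin)
open import Data.List.Extrema.Nat using (argmin; f[argmin]≤f[xs])
open import Data.List.Membership.Propositional.Properties using (∈-allFin)
import Data.List.Relation.Unary.All as All
open import Data.Nat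
  using (ℕ; zero; suc; _+_; _*_; _∸_; _≤_; _<_; _⊓_; _⊔_; _%_; _/_; z≤n; s≤s; s≤s⁻¹; z<s; NonZero)
open import Data.Nat.DivMod
  using (_mod_; m≡m%n+[m/n]*n; %-distribˡ-+; m%n%n≡m%n; [m+n]%n≡m%n; m<n⇒m%n≡m; n%n≡0)
open import Data.Nat.Properties
open import Data.Product using (_×_; _,_; ∃-syntax; uncurry)
open import Data.Sum using (_⊎_; inj₁; inj₂)
open import Function using (_∘_)
open import Function.Definitions using (Injective)
open import Relation.Binary using (tri<; tri≈; tri>)
open import Relation.Binary.PropositionalEquality
  using (_≡_; _≢_; refl; sym; trans; cong; subst; subst₂; ≢-sym; module ≡-Reasoning)
open import Relation.Nullary using (¬_; Dec; yes; no)
open import Relation.Nullary.Decidable using (_×-dec_; _⊎-dec_; decidable-stable)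
open import Relation.Unary using (Pred; Decidable)

open ≡-Reasoning

module _ {N : ℕ} {a b x : Fin N} where

  inside-sym : StrictlyInside a b x → StrictlyInside b a x
  inside-sym (lo , hi) =
    subst (_< toℕ x) (⊓-comm (toℕ a) (toℕ b)) lo ,
    subst (toℕ x <_) (⊔-comm (toℕ a) (toℕ b)) hi

  outside-sym : StrictlyOutside a b x → StrictlyOutside b a x
  outside-sym (inj₁ below) = inj₁ (subst (toℕ x <_) (⊓-comm (toℕ a) (toℕ b)) below)
  outside-sym (inj₂ above) = inj₂ (subst (_< toℕ x) (⊔-comm (toℕ a) (toℕ b)) above)

  <-inside : toℕ a < toℕ x → toℕ x < toℕ b → StrictlyInside a b x
  <-inside a<x x<b = ≤-<-trans (m⊓n≤m _ _) a<x , <-≤-trans x<b (m≤n⊔m _ _)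

  inside⇒¬outside : StrictlyInside a b x → ¬ StrictlyOutside a b x
  inside⇒¬outside (lo , _) (inj₁ below) = <-asym lo below
  inside⇒¬outside (_ , hi) (inj₂ above) = <-asym hi above

  inside⇒≢ˡ : StrictlyInside a b x → x ≢ a
  inside⇒≢ˡ (lo , hi) refl with ≤-total (toℕ a) (toℕ b)
  ... | inj₁ a≤b = <-irrefl (m≤n⇒m⊓n≡m a≤b) lo
  ... | inj₂ b≤a = <-irrefl (sym (m≥n⇒m⊔n≡m b≤a)) hi

  outside⇒≢ˡ : StrictlyOutside a b x → x ≢ a
  outside⇒≢ˡ (inj₁ below) refl = <⇒≱ below (m⊓n≤m (toℕ a) (toℕ b))
  outside⇒≢ˡ (inj₂ above) refl = <⇒≱ above (m≤m⊔n (toℕ a) (toℕ b))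

  private
    ≢-endpoint : x ≢ a → x ≢ b → ∀ {m} → m ≡ toℕ a ⊎ m ≡ toℕ b → toℕ x ≢ m
    ≢-endpoint x≢a _   (inj₁ refl) = x≢a ∘ toℕ-injective
    ≢-endpoint _   x≢b (inj₂ refl) = x≢b ∘ toℕ-injective

  ¬inside⇒outside : x ≢ a → x ≢ b → ¬ StrictlyInside a b x → StrictlyOutside a b x
  ¬inside⇒outside x≢a x≢b ¬inside with toℕ a ⊓ toℕ b <? toℕ x | toℕ x <? toℕ a ⊔ toℕ b
  ... | yes lo | yes hi = ⊥-elim (¬inside (lo , hi))
  ... | no ¬lo | _      =
    inj₁ (≤∧≢⇒< (≮⇒≥ ¬lo) (≢-endpoint x≢a x≢b (⊓-sel (toℕ a) (toℕ b))))
  ... | yes _  | no ¬hi =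
    inj₂ (≤∧≢⇒< (≮⇒≥ ¬hi) (≢-sym (≢-endpoint x≢a x≢b (⊔-sel (toℕ a) (toℕ b)))))

inside? : ∀ {N} (a b x : Fin N) → Dec (StrictlyInside a b x)
inside? a b x = (toℕ a ⊓ toℕ b <? toℕ x) ×-dec (toℕ x <? toℕ a ⊔ toℕ b)

outside? : ∀ {N} (a b x : Fin N) → Dec (StrictlyOutside a b x)
outside? a b x = (toℕ x <? toℕ a ⊓ toℕ b) ⊎-dec (toℕ a ⊔ toℕ b <? toℕ x)

¬outside⇒inside : ∀ {N} {a b x : Fin N} → x ≢ a → x ≢ b →
                  ¬ StrictlyOutside a b x → StrictlyInside a b x
¬outside⇒inside {a = a} {b} {x} x≢a x≢b ¬outside =
  decidable-stable (inside? a b x) (¬outside ∘ ¬inside⇒outside x≢a x≢b)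

inside⇒≢ʳ : ∀ {N} {a b x : Fin N} → StrictlyInside a b x → x ≢ b
inside⇒≢ʳ = inside⇒≢ˡ ∘ inside-sym

outside⇒≢ʳ : ∀ {N} {a b x : Fin N} → StrictlyOutside a b x → x ≢ b
outside⇒≢ʳ = outside⇒≢ˡ ∘ outside-sym

Cross-swap : ∀ {N} {a b c d : Fin N} → Cross a b c d → Cross b a d c
Cross-swap (inj₁ (inside , outside)) = inj₂ (inside-sym inside , outside-sym outside)
Cross-swap (inj₂ (inside , outside)) = inj₁ (inside-sym inside , outside-sym outside)

exit-point : ∀ {ℓ} {A : Pred ℕ ℓ} → Decidable A → ∀ {m n} → m ≤ n → A m → ¬ A n →
             ∃[ r ] m ≤ r × r < n × A r × ¬ A (suc r)
exit-point A? m≤n Am ¬An with m≤n⇒m<n∨m≡n m≤n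
... | inj₂ refl = ⊥-elim (¬An Am)
... | inj₁ (s≤s {n = n} m≤n′) with A? n
...   | yes An = n , m≤n′ , n<1+n n , An , ¬An
...   | no ¬An′ =
  let r , m≤r , r<n , Ar , ¬Ar′ = exit-point A? m≤n′ Am ¬An′
  in  r , m≤r , m<n⇒m<1+n r<n , Ar , ¬Ar′

empty-edges⇒ascending : ∀ {N L} (seq : ℕ → Fin N) →
  (∀ {i j} → i < j → j < L → seq i ≢ seq j) →
  (∀ i → suc i < L → ∀ {k} → k < L → ¬ StrictlyInside (seq i) (seq (suc i)) (seq k)) →
  toℕ (seq 0) < toℕ (seq 1) → ∀ i → suc i < L → toℕ (seq i) < toℕ (seq (suc i))
empty-edges⇒ascending seq distinct empty start zero _ = start
empty-edges⇒ascending {L = L} seq distinct empty start (suc i) i+2<L =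
  step (empty-edges⇒ascending seq distinct empty start i i+1<L)
  where
  i+1<L : suc i < L
  i+1<L = <-trans (n<1+n (suc i)) i+2<L
  i<L : i < L
  i<L = <-trans (n<1+n i) i+1<L
  -- If the path turned down at seq (suc i), then seq (suc (suc i)) would lie inside edge i
  -- or seq i inside edge suc i.
  step : toℕ (seq i) < toℕ (seq (suc i)) → toℕ (seq (suc i)) < toℕ (seq (suc (suc i)))
  step a<b with <-cmp (toℕ (seq (suc i))) (toℕ (seq (suc (suc i))))
  ... | tri< b<c _ _ = b<c
  ... | tri≈ _ b≡c _ = ⊥-elim (distinct (n<1+n (suc i)) i+2<L (toℕ-injective b≡c))
  ... | tri> _ _ c<b with <-cmp (toℕ (seq i)) (toℕ (seq (suc (suc i))))
  ...   | tri< a<c _ _ = ⊥-elim (empty i i+1<L i+2<L (<-inside a<c c<b))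
  ...   | tri≈ _ a≡c _ =
    ⊥-elim (distinct (<-trans (n<1+n i) (n<1+n (suc i))) i+2<L (toℕ-injective a≡c))
  ...   | tri> _ _ c<a = ⊥-elim (empty (suc i) i+2<L i<L (inside-sym (<-inside c<a a<b)))

steps⇒increasing : ∀ {L} (h : ℕ → ℕ) → (∀ i → suc i < L → h i < h (suc i)) →
                   ∀ {i j} → i < j → j < L → h i < h j
steps⇒increasing h step {i} {suc j} i<1+j 1+j<L with m≤n⇒m<n∨m≡n (s≤s⁻¹ i<1+j)
... | inj₁ i<j = <-trans (steps⇒increasing h step i<j (<-trans (n<1+n j) 1+j<L)) (step j 1+j<L)
... | inj₂ refl = step j 1+j<L

-- A copy of C_n unrolled along ℕ: index k stands for the cycle vertex k mod n.
record NonCrossingCycle (N n : ℕ) : Set where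
  field
    vertex      : ℕ → Fin N
    periodic    : ∀ k → vertex (k + n) ≡ vertex k
    injective   : ∀ {j k} → j < k → k < j + n → vertex j ≢ vertex k
    nonCrossing : ∀ j k → ¬ Cross (vertex j) (vertex (suc j)) (vertex k) (vertex (suc k))

module _ {N n} (C : NonCrossingCycle N n) where
  open NonCrossingCycle C

  InsideEdge : ℕ → ℕ → Set
  InsideEdge j k = StrictlyInside (vertex j) (vertex (suc j)) (vertex k)

  OutsideEdge : ℕ → ℕ → Set
  OutsideEdge j k = StrictlyOutside (vertex j) (vertex (suc j)) (vertex k)

  lift-into-window : ∀ {j k} → j < n → k < n →
                     vertex k ≢ vertex j → vertex k ≢ vertex (suc j) →
                     ∃[ K ] suc j < K × K < j + n × vertex K ≡ vertex k
  lift-into-window {j} {k} j<n k<n k≢j k≢j+1 with <-cmp k j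
  ... | tri< k<j _ _ =
    k + n , ≤∧≢⇒< (≤-trans j<n (m≤n+m n k)) (k≢j+1 ∘ trans (sym (periodic k)) ∘ cong vertex ∘ sym)
          , +-monoˡ-< n k<j , periodic k
  ... | tri≈ _ refl _ = ⊥-elim (k≢j refl)
  ... | tri> _ _ j<k =
    k , ≤∧≢⇒< j<k (k≢j+1 ∘ cong vertex ∘ sym) , <-≤-trans k<n (m≤n+m n j) , refl

  window-≢ : ∀ {j r} → suc j < r → r < j + n →
             vertex r ≢ vertex j × vertex r ≢ vertex (suc j)
  window-≢ {j} j+1<r r<j+n =
    ≢-sym (injective (<-trans (n<1+n j) j+1<r) r<j+n) , ≢-sym (injective j+1<r (m<n⇒m<1+n r<j+n))

  no-straddle-in-window : ∀ {j P Q} → suc j < P → P < j + n → suc j < Q → Q < j + n →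
                          InsideEdge j P → ¬ OutsideEdge j Q
  no-straddle-in-window {j} {P} {Q} j+1<P P<j+n j+1<Q Q<j+n inP outQ with ≤-total P Q
  ... | inj₁ P≤Q =
    let r , P≤r , r<Q , inR , ¬inR+1 =
          exit-point (λ r → inside? _ _ (vertex r)) P≤Q inP (λ inQ → inside⇒¬outside inQ outQ)
        r+1∈window = window-≢ (<-trans (<-≤-trans j+1<P P≤r) (n<1+n r)) (≤-<-trans r<Q Q<j+n)
    in nonCrossing j r (inj₁ (inR , uncurry ¬inside⇒outside r+1∈window ¬inR+1))
  ... | inj₂ Q≤P =
    let r , Q≤r , r<P , outR , ¬outR+1 =
          exit-point (λ r → outside? _ _ (vertex r)) Q≤P outQ (inside⇒¬outside inP)
        r+1∈window = window-≢ (<-trans (<-≤-trans j+1<Q Q≤r) (n<1+n r)) (≤-<-trans r<P P<j+n)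
    in nonCrossing j r (inj₂ (uncurry ¬outside⇒inside r+1∈window ¬outR+1 , outR))

  outside⇒no-inside : ∀ {j l} → j < n → l < n → OutsideEdge j l →
                      ∀ {k} → k < n → ¬ InsideEdge j k
  outside⇒no-inside j<n l<n outL k<n inK =
    let P , j+1<P , P<j+n , vP≡vk = lift-into-window j<n k<n (inside⇒≢ˡ inK) (inside⇒≢ʳ inK)
        Q , j+1<Q , Q<j+n , vQ≡vl =
          lift-into-window j<n l<n (outside⇒≢ˡ outL) (outside⇒≢ʳ outL)
    in no-straddle-in-window j+1<P P<j+n j+1<Q Q<j+n
         (subst (StrictlyInside _ _) (sym vP≡vk) inK) (subst (StrictlyOutside _ _) (sym vQ≡vl) outL)

  rooted-increasing : 3 ≤ n → (∀ k → toℕ (vertex 0) ≤ toℕ (vertex k)) →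
                      toℕ (vertex 1) < toℕ (vertex (n ∸ 1)) →
                      ∀ {i j} → i < j → j < n → toℕ (vertex i) < toℕ (vertex j)
  rooted-increasing (s≤s (s≤s (s≤s _))) rooted upward =
    steps⇒increasing (toℕ ∘ vertex) (empty-edges⇒ascending vertex distinct empty start)
    where
    distinct : ∀ {i j} → i < j → j < n → vertex i ≢ vertex j
    distinct {i} i<j j<n = injective i<j (<-≤-trans j<n (m≤n+m n i))
    above-root : ∀ {k} → 0 < k → k < n → toℕ (vertex 0) < toℕ (vertex k)
    above-root 0<k k<n = ≤∧≢⇒< (rooted _) (distinct 0<k k<n ∘ toℕ-injective)
    start : toℕ (vertex 0) < toℕ (vertex 1)
    start = above-root z<s (s≤s (s≤s z≤n))
    empty : ∀ i → suc i < n → ∀ {k} → k < n → ¬ InsideEdge i k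
    empty zero 1<n =
      outside⇒no-inside z<s (n<1+n _) (inj₂ (⊔-lub (above-root z<s (n<1+n _)) upward))
    empty (suc i) i+2<n =
      outside⇒no-inside (<-trans (n<1+n _) i+2<n) z<s
        (inj₁ (⊓-glb (above-root z<s (<-trans (n<1+n _) i+2<n)) (above-root z<s i+2<n)))

[m+n%d]%d≡[m+n]%d : ∀ m n d .{{_ : NonZero d}} → (m + n % d) % d ≡ (m + n) % d
[m+n%d]%d≡[m+n]%d m n d = begin
  (m + n % d) % d          ≡⟨ %-distribˡ-+ m (n % d) d ⟩
  (m % d + n % d % d) % d  ≡⟨ cong (λ k → (m % d + k) % d) (m%n%n≡m%n n d) ⟩
  (m % d + n % d) % d      ≡⟨ %-distribˡ-+ m n d ⟨
  (m + n) % d              ∎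

m%n≢[m+o]%n : ∀ m {o n} .{{_ : NonZero n}} → 0 < o → o < n → m % n ≢ (m + o) % n
-- Equal remainders would force the quotients of m and m + o to satisfy q < q′ < q + 1.
m%n≢[m+o]%n m {o} {n} 0<o o<n eq = <-irrefl refl (<-≤-trans q<q′ (s≤s⁻¹ q′<1+q))
  where
  q q′ : ℕ
  q  = m / n
  q′ = (m + o) / n
  shift : q * n + o ≡ q′ * n
  shift = +-cancelˡ-≡ (m % n) _ _ (begin
    m % n + (q * n + o)   ≡⟨ +-assoc (m % n) (q * n) o ⟨
    m % n + q * n + o     ≡⟨ cong (_+ o) (m≡m%n+[m/n]*n m n) ⟨
    m + o                 ≡⟨ m≡m%n+[m/n]*n (m + o) n ⟩
    (m + o) % n + q′ * n  ≡⟨ cong (_+ q′ * n) eq ⟨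
    m % n + q′ * n        ∎)
  q<q′ : q < q′
  q<q′ = *-cancelʳ-< n q q′ (subst (q * n <_) shift (m<m+n (q * n) 0<o))
  q′<1+q : q′ < suc q
  q′<1+q = *-cancelʳ-< n q′ (suc q)
    (subst (_< suc q * n) shift (subst (q * n + o <_) (+-comm (q * n) n) (+-monoʳ-< (q * n) o<n)))

rotate : ∀ {n} → Fin (suc n) → ℕ → Fin (suc n)
rotate {n} s k = (toℕ s + k) mod suc n

module _ {n : ℕ} (s : Fin (suc n)) where

  toℕ-rotate : ∀ k → toℕ (rotate s k) ≡ (toℕ s + k) % suc n
  toℕ-rotate k = toℕ-fromℕ< _

  rotate-zero : rotate s 0 ≡ s
  rotate-zero = toℕ-injective (begin
    toℕ (rotate s 0)      ≡⟨ toℕ-rotate 0 ⟩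
    (toℕ s + 0) % suc n   ≡⟨ cong (_% suc n) (+-identityʳ (toℕ s)) ⟩
    toℕ s % suc n         ≡⟨ m<n⇒m%n≡m (toℕ<n s) ⟩
    toℕ s                 ∎)

  next-rotate : ∀ k → next (rotate s k) ≡ rotate s (suc k)
  next-rotate k = toℕ-injective (begin
    toℕ (next (rotate s k))            ≡⟨ toℕ-fromℕ< _ ⟩
    suc (toℕ (rotate s k)) % suc n     ≡⟨ cong (λ r → suc r % suc n) (toℕ-rotate k) ⟩
    (1 + (toℕ s + k) % suc n) % suc n  ≡⟨ [m+n%d]%d≡[m+n]%d 1 (toℕ s + k) (suc n) ⟩
    suc (toℕ s + k) % suc n            ≡⟨ cong (_% suc n) (+-suc (toℕ s) k) ⟨
    (toℕ s + suc k) % suc n            ≡⟨ toℕ-rotate (suc k) ⟨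
    toℕ (rotate s (suc k))             ∎)

  rotate-mod : ∀ k → rotate s (k % suc n) ≡ rotate s k
  rotate-mod k = toℕ-injective (begin
    toℕ (rotate s (k % suc n))     ≡⟨ toℕ-rotate (k % suc n) ⟩
    (toℕ s + k % suc n) % suc n    ≡⟨ [m+n%d]%d≡[m+n]%d (toℕ s) k (suc n) ⟩
    (toℕ s + k) % suc n            ≡⟨ toℕ-rotate k ⟨
    toℕ (rotate s k)               ∎)

  rotate-periodic : ∀ k → rotate s (k + suc n) ≡ rotate s k
  rotate-periodic k = toℕ-injective (begin
    toℕ (rotate s (k + suc n))     ≡⟨ toℕ-rotate (k + suc n) ⟩
    (toℕ s + (k + suc n)) % suc n  ≡⟨ cong (_% suc n) (+-assoc (toℕ s) k (suc n)) ⟨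
    (toℕ s + k + suc n) % suc n    ≡⟨ [m+n]%n≡m%n (toℕ s + k) (suc n) ⟩
    (toℕ s + k) % suc n            ≡⟨ toℕ-rotate k ⟨
    toℕ (rotate s k)               ∎)

  rotate-injective : ∀ {j k} → j < k → k < j + suc n → rotate s j ≢ rotate s k
  rotate-injective {j} {k} j<k k<j+n eq = m%n≢[m+o]%n (toℕ s + j) (m<n⇒0<n∸m j<k) gap<n (begin
    (toℕ s + j) % suc n              ≡⟨ toℕ-rotate j ⟨
    toℕ (rotate s j)                 ≡⟨ cong toℕ eq ⟩
    toℕ (rotate s k)                 ≡⟨ toℕ-rotate k ⟩
    (toℕ s + k) % suc n              ≡⟨ cong (λ m → (toℕ s + m) % suc n) j+gap≡k ⟨
    (toℕ s + (j + (k ∸ j))) % suc n  ≡⟨ cong (_% suc n) (+-assoc (toℕ s) j (k ∸ j)) ⟨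
    (toℕ s + j + (k ∸ j)) % suc n    ∎)
    where
    j+gap≡k : j + (k ∸ j) ≡ k
    j+gap≡k = m+[n∸m]≡n (<⇒≤ j<k)
    gap<n : k ∸ j < suc n
    gap<n = +-cancelˡ-< j (k ∸ j) (suc n) (subst (_< j + suc n) (sym j+gap≡k) k<j+n)

module _ {n : ℕ} where

  toℕ-next-< : (i : Fin (suc n)) → toℕ i < n → toℕ (next i) ≡ suc (toℕ i)
  toℕ-next-< i i<n = trans (toℕ-fromℕ< _) (m<n⇒m%n≡m (s≤s i<n))

  toℕ-next-last : (i : Fin (suc n)) → toℕ i ≡ n → toℕ (next i) ≡ 0
  toℕ-next-last i i≡n =
    trans (toℕ-fromℕ< _) (trans (cong (λ m → suc m % suc n) i≡n) (n%n≡0 (suc n)))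

  next-opposite-next : (i : Fin (suc n)) → next (opposite (next i)) ≡ opposite i
  next-opposite-next i with m≤n⇒m<n∨m≡n (toℕ≤pred[n] i)
  ... | inj₁ i<n = toℕ-injective (begin
    toℕ (next (opposite (next i)))  ≡⟨ toℕ-next-< (opposite (next i)) opp<n ⟩
    suc (toℕ (opposite (next i)))   ≡⟨ cong suc opp ⟩
    suc (n ∸ suc (toℕ i))           ≡⟨ +-∸-assoc 1 i<n ⟨
    n ∸ toℕ i                       ≡⟨ opposite-prop i ⟨
    toℕ (opposite i)                ∎)
    where
    opp : toℕ (opposite (next i)) ≡ n ∸ suc (toℕ i)
    opp = trans (opposite-prop (next i)) (cong (n ∸_) (toℕ-next-< i i<n))
    opp<n : toℕ (opposite (next i)) < n
    opp<n = subst (_< n) (sym opp) (∸-monoʳ-< z<s i<n)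
  ... | inj₂ i≡n = toℕ-injective (begin
    toℕ (next (opposite (next i)))  ≡⟨ toℕ-next-last (opposite (next i)) opp ⟩
    0                               ≡⟨ n∸n≡0 n ⟨
    n ∸ n                           ≡⟨ cong (n ∸_) i≡n ⟨
    n ∸ toℕ i                       ≡⟨ opposite-prop i ⟨
    toℕ (opposite i)                ∎)
    where
    opp : toℕ (opposite (next i)) ≡ n
    opp = trans (opposite-prop (next i)) (cong (n ∸_) (toℕ-next-last i i≡n))

-- Defined through opposite so that reflecting a cycle by opposite exchanges next and prev.
prev : ∀ {n} → Fin (suc n) → Fin (suc n)
prev i = opposite (next (opposite i))

module _ {n : ℕ} where

  opposite-injective : Injective _≡_ _≡_ (opposite {suc n})
  opposite-injective {i} {j} e =
    trans (sym (opposite-involutive i)) (trans (cong opposite e) (opposite-involutive j))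

  prev-next : (i : Fin (suc n)) → prev (next i) ≡ i
  prev-next i = trans (cong opposite (next-opposite-next i)) (opposite-involutive i)

  opposite-prev-opposite : (i : Fin (suc n)) → opposite (prev (opposite i)) ≡ next i
  opposite-prev-opposite i = trans (opposite-involutive _) (cong next (opposite-involutive i))

  rotate-one : (s : Fin (suc n)) → rotate s 1 ≡ next s
  rotate-one s = trans (sym (next-rotate s 0)) (cong next (rotate-zero s))

  rotate-last : (s : Fin (suc n)) → rotate s n ≡ prev s
  rotate-last s = begin
    rotate s n                ≡⟨ prev-next (rotate s n) ⟨
    prev (next (rotate s n))  ≡⟨ cong prev (next-rotate s n) ⟩
    prev (rotate s (suc n))   ≡⟨ cong prev (rotate-periodic s 0) ⟩
    prev (rotate s 0)         ≡⟨ cong prev (rotate-zero s) ⟩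
    prev s                    ∎

  next≢prev : 2 ≤ n → (s : Fin (suc n)) → next s ≢ prev s
  next≢prev 2≤n s eq =
    rotate-injective s 2≤n (m<n⇒m<1+n (n<1+n n))
      (trans (rotate-one s) (trans eq (sym (rotate-last s))))

EdgesColoured : ∀ {N n} → Coloring N → Bool → (Fin (suc n) → Fin N) → Set
EdgesColoured c col f = ∀ i → c (f i) (f (next i)) ≡ col

NonCrossing : ∀ {N n} → (Fin (suc n) → Fin N) → Set
NonCrossing f = ∀ i j → ¬ Cross (f i) (f (next i)) (f j) (f (next j))

module _ {N n} {f : Fin (suc n) → Fin N} where

  colouring-reflected : ∀ {c : Coloring N} {col} → Symmetric c →
                        EdgesColoured c col f → EdgesColoured c col (f ∘ opposite)
  colouring-reflected {c} {col} symmetric coloured i =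
    subst (λ x → c (f x) (f (opposite (next i))) ≡ col) (next-opposite-next i)
      (trans (symmetric _ _) (coloured (opposite (next i))))

  nonCrossing-reflected : NonCrossing f → NonCrossing (f ∘ opposite)
  nonCrossing-reflected nonCrossing i j cross =
    nonCrossing (opposite (next i)) (opposite (next j)) (Cross-swap
      (subst₂ (λ x y → Cross (f x) (f (opposite (next i))) (f y) (f (opposite (next j))))
        (sym (next-opposite-next i)) (sym (next-opposite-next j)) cross))

unrolled : ∀ {N n} {f : Fin (suc n) → Fin N} → Injective _≡_ _≡_ f → NonCrossing f →
           Fin (suc n) → NonCrossingCycle N (suc n)
unrolled {f = f} f-injective nonCrossing s = record
  { vertex      = f ∘ rotate s
  ; periodic    = cong f ∘ rotate-periodic s
  ; injective   = λ j<k k<j+n → rotate-injective s j<k k<j+n ∘ f-injective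
  ; nonCrossing = λ j k → subst₂ (λ x y → ¬ Cross (f (rotate s j)) (f x) (f (rotate s k)) (f y))
                            (next-rotate s j) (next-rotate s k) (nonCrossing (rotate s j) (rotate s k))
  }

monotone-from-minimum : ∀ {N n} {c : Coloring N} {col} {f : Fin (suc n) → Fin N} →
  Injective _≡_ _≡_ f → EdgesColoured c col f → NonCrossing f → 2 ≤ n →
  (s : Fin (suc n)) → (∀ i → toℕ (f s) ≤ toℕ (f i)) → toℕ (f (next s)) < toℕ (f (prev s)) →
  MonotoneMonoCycle (suc n) c
monotone-from-minimum {n = n} {c} {col} {f} f-injective coloured nonCrossing 2≤n s minimal upward =
  col , f ∘ rotate s ∘ toℕ , increasing , coloured-in-order
  where
  rooted : ∀ k → toℕ (f (rotate s 0)) ≤ toℕ (f (rotate s k))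
  rooted k rewrite rotate-zero s = minimal (rotate s k)
  increasing : ∀ i j → toℕ i < toℕ j → toℕ (f (rotate s (toℕ i))) < toℕ (f (rotate s (toℕ j)))
  increasing i j i<j = rooted-increasing (unrolled f-injective nonCrossing s) (s≤s 2≤n) rooted
    (subst₂ (λ x y → toℕ (f x) < toℕ (f y)) (sym (rotate-one s)) (sym (rotate-last s)) upward)
    i<j (toℕ<n j)
  coloured-in-order : ∀ i → c (f (rotate s (toℕ i))) (f (rotate s (toℕ (next i)))) ≡ col
  coloured-in-order i = subst (λ x → c (f (rotate s (toℕ i))) (f x) ≡ col) (begin
    next (rotate s (toℕ i))         ≡⟨ next-rotate s (toℕ i) ⟩
    rotate s (suc (toℕ i))          ≡⟨ rotate-mod s (suc (toℕ i)) ⟨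
    rotate s (suc (toℕ i) % suc n)  ≡⟨ cong (rotate s) (toℕ-fromℕ< _) ⟨
    rotate s (toℕ (next i))         ∎) (coloured (rotate s (toℕ i)))

minimum-point : ∀ {n} (h : Fin (suc n) → ℕ) → ∃[ s ] ∀ i → h s ≤ h i
minimum-point h =
  argmin h Fin.zero (allFin _) ,
  λ i → All.lookup (f[argmin]≤f[xs] {f = h} Fin.zero (allFin _)) (∈-allFin i)

monotone-copy : ∀ {N n} {c : Coloring N} → Symmetric c → 3 ≤ n →
                NonCrossingMonoCycle n c → MonotoneMonoCycle n c
monotone-copy {n = suc n} {c} symmetric (s≤s 2≤n) (col , f , f-injective , coloured , nonCrossing)
  with minimum-point (toℕ ∘ f)
... | s , minimal with <-cmp (toℕ (f (next s))) (toℕ (f (prev s)))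
...   | tri< upward _ _ =
  monotone-from-minimum {c = c} f-injective coloured nonCrossing 2≤n s minimal upward
...   | tri≈ _ e _ = ⊥-elim (next≢prev 2≤n s (f-injective (toℕ-injective e)))
...   | tri> _ _ downward =
  monotone-from-minimum {c = c} (opposite-injective ∘ f-injective)
    (colouring-reflected {c = c} symmetric coloured) (nonCrossing-reflected nonCrossing)
    2≤n (opposite s) minimal′ upward′
  where
  minimal′ : ∀ i → toℕ (f (opposite (opposite s))) ≤ toℕ (f (opposite i))
  minimal′ i rewrite opposite-involutive s = minimal (opposite i)
  upward′ : toℕ (f (prev s)) < toℕ (f (opposite (prev (opposite s))))
  upward′ = subst (λ x → toℕ (f (prev s)) < toℕ (f x)) (sym (opposite-prev-opposite s)) downward

module _ {N n} {g : Fin (suc n) → Fin N}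
         (increasing : ∀ i j → toℕ i < toℕ j → toℕ (g i) < toℕ (g j)) where

  reflects-< : ∀ {i j} → toℕ (g i) < toℕ (g j) → toℕ i < toℕ j
  reflects-< {i} {j} gi<gj with <-cmp (toℕ i) (toℕ j)
  ... | tri< i<j _ _ = i<j
  ... | tri≈ _ i≡j _ = ⊥-elim (<-irrefl (cong (toℕ ∘ g) (toℕ-injective i≡j)) gi<gj)
  ... | tri> _ _ j<i = ⊥-elim (<-asym gi<gj (increasing j i j<i))

  increasing⇒injective : Injective _≡_ _≡_ g
  increasing⇒injective {i} {j} gi≡gj with <-cmp (toℕ i) (toℕ j)
  ... | tri< i<j _ _ = ⊥-elim (<-irrefl (cong toℕ gi≡gj) (increasing i j i<j))
  ... | tri≈ _ i≡j _ = toℕ-injective i≡j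
  ... | tri> _ _ j<i = ⊥-elim (<-irrefl (cong toℕ (sym gi≡gj)) (increasing j i j<i))

  -- Edges {g i, g (i+1)} have no vertex strictly inside; the closing edge has none strictly outside.
  increasing⇒nonCrossing : NonCrossing g
  increasing⇒nonCrossing i j cross with m≤n⇒m<n∨m≡n (toℕ≤pred[n] i)
  ... | inj₁ i<n = no-inside cross
    where
    gi≤g[next] : toℕ (g i) ≤ toℕ (g (next i))
    gi≤g[next] = <⇒≤ (increasing i (next i) (subst (toℕ i <_) (sym (toℕ-next-< i i<n)) (n<1+n _)))
    ¬inside : ∀ y → ¬ StrictlyInside (g i) (g (next i)) (g y)
    ¬inside y (lo , hi) =
      let i<y    = reflects-< (subst (_< toℕ (g y)) (m≤n⇒m⊓n≡m gi≤g[next]) lo)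
          y<next = reflects-< (subst (toℕ (g y) <_) (m≤n⇒m⊔n≡n gi≤g[next]) hi)
      in  <⇒≱ i<y (s≤s⁻¹ (subst (toℕ y <_) (toℕ-next-< i i<n) y<next))
    no-inside : ¬ Cross (g i) (g (next i)) (g j) (g (next j))
    no-inside (inj₁ (inside , _)) = ¬inside j inside
    no-inside (inj₂ (inside , _)) = ¬inside (next j) inside
  ... | inj₂ i≡n = no-outside cross
    where
    ¬outside : ∀ y → ¬ StrictlyOutside (g i) (g (next i)) (g y)
    ¬outside y (inj₁ below) =
      let y<next = reflects-< (<-≤-trans below (m⊓n≤n _ _))
      in  <⇒≱ (subst (toℕ y <_) (toℕ-next-last i i≡n) y<next) z≤n
    ¬outside y (inj₂ above) =
      <⇒≱ (subst (_< toℕ y) i≡n (reflects-< (≤-<-trans (m≤m⊔n _ _) above))) (toℕ≤pred[n] y)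
    no-outside : ¬ Cross (g i) (g (next i)) (g j) (g (next j))
    no-outside (inj₁ (_ , outside)) = ¬outside (next j) outside
    no-outside (inj₂ (_ , outside)) = ¬outside j outside

nonCrossing-copy : ∀ {N n} {c : Coloring N} → 1 ≤ n →
                   MonotoneMonoCycle n c → NonCrossingMonoCycle n c
nonCrossing-copy (s≤s z≤n) (col , g , increasing , coloured) =
  col , g , increasing⇒injective increasing , coloured , increasing⇒nonCrossing increasing

convex⇒ordered : ∀ {n N} → 3 ≤ n → ConvexRamseyProp n N → OrderedRamseyProp n N
convex⇒ordered 3≤n convex c symmetric = monotone-copy symmetric 3≤n (convex c symmetric)

ordered⇒convex : ∀ {n N} → 3 ≤ n → OrderedRamseyProp n N → ConvexRamseyProp n N
ordered⇒convex 3≤n ordered c symmetric =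
  nonCrossing-copy {c = c} (≤-trans (s≤s z≤n) 3≤n) (ordered c symmetric)

least-transfer : ∀ {P Q : ℕ → Set} {R} → (∀ {N} → P N → Q N) → (∀ {N} → Q N → P N) →
                 IsLeast P R → IsLeast Q R
least-transfer p⇒q q⇒p (pR , least) = p⇒q pR , λ M qM → least M (q⇒p qM)

mainTheorem8 : ∀ (n : ℕ) → 3 ≤ n → ∀ (R : ℕ) →
                 (IsConvexRamseyNumber n R → IsOrderedRamseyNumber n R)
                 × (IsOrderedRamseyNumber n R → IsConvexRamseyNumber n R)
mainTheorem8 n 3≤n R =
  least-transfer (convex⇒ordered 3≤n) (ordered⇒convex 3≤n) ,
  least-transfer (ordered⇒convex 3≤n) (convex⇒ordered 3≤n)
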